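{- Let $G$ be a graph with $n \ge 2$ vertices. Then every self-identifying code of $G$ is also a redundant identifying code of $G$.
   Context: All graphs are simple, undirected and connected. For $v \in V(G)$, $N[v] = N(v) \cup \{v\}$ is the closed neighborhood, and for $S \subseteq V(G)$ write $N_S[v] = N[v] \cap S$. A set $S \subseteq V(G)$ is a self-identifying code (SIC) of $G$ if for every $x \in V(G)$ we have $N_S[x] \neq \varnothing$ and $\bigcap_{v \in N_S[x]} N[v] = \{x\}$. A set $S \subseteq V(G)$ is a redundant identifying code (RED:IC) if $|N_S[u]| \ge 2$ for every $u \in V(G)$ and $|N_S[u] \setminus N_S[v]| + |N_S[v] \setminus N_S[u]| \ge 2$ for all distinct $u,v \in V(G)$. -}

module Defs where

open import Data.Nat using (ℕ; zero; suc; _≤_)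
open import Data.Bool using (Bool; true; false; _∨_)
open import Data.Fin using (Fin; _≟_)
open import Data.Fin.Subset using (Subset; _∈_; _∩_; _─_; ∣_∣; Nonempty)
open import Data.Vec using (tabulate)
open import Data.Product using (_×_; Σ)
open import Relation.Nullary using (¬_)
open import Relation.Nullary.Decidable using (⌊_⌋)
open import Relation.Binary.PropositionalEquality using (_≡_; _≢_)

data Walk {n : ℕ} (adj : Fin n → Fin n → Bool) : Fin n → Fin n → Set where
  here  : ∀ {u} → Walk adj u u
  there : ∀ {u w v} → adj u w ≡ true → Walk adj w v → Walk adj u v

record Graph (n : ℕ) : Set where
  field
    adj       : Fin n → Fin n → Bool
    symmetric : ∀ u v → adj u v ≡ adj v u
    irreflex  : ∀ v → adj v v ≡ false
    connected : ∀ u v → Walk adj u v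

open Graph public

N[_]_ : ∀ {n} → Graph n → Fin n → Subset n
N[ G ] v = tabulate (λ u → ⌊ u ≟ v ⌋ ∨ adj G v u)

N[_]_∩S_ : ∀ {n} → Graph n → Fin n → Subset n → Subset n
N[ G ] v ∩S S = (N[ G ] v) ∩ S

InBigCap : ∀ {n} → Graph n → Subset n → Fin n → Fin n → Set
InBigCap G S x y = ∀ v → v ∈ (N[ G ] x ∩S S) → y ∈ (N[ G ] v)

IsSIC : ∀ {n} → Graph n → Subset n → Set
IsSIC G S = ∀ x → Nonempty (N[ G ] x ∩S S)
                × (∀ y → (InBigCap G S x y → y ≡ x) × (y ≡ x → InBigCap G S x y))

IsREDIC : ∀ {n} → Graph n → Subset n → Set
IsREDIC G S =
  (∀ u → 2 ≤ ∣ N[ G ] u ∩S S ∣)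
  × (∀ u v → u ≢ v →
       2 ≤ ∣ (N[ G ] u ∩S S) ─ (N[ G ] v ∩S S) ∣ Data.Nat.+ ∣ (N[ G ] v ∩S S) ─ (N[ G ] u ∩S S) ∣)

-- Distinct vertices x ≠ y are separated by a codeword: since y is not in ⋂_{c ∈ N_S[x]} N[c],
-- some c ∈ N_S[x] is not adjacent to y (nor equal to it).  Applied to two distinct vertices
-- (in both orders) this makes both differences N_S[u] ∖ N_S[v] and N_S[v] ∖ N_S[u] nonempty.
-- For |N_S[x]| ≥ 2, take a neighbour w of x (it exists as G is connected with n ≥ 2): some
-- c ∈ N_S[x] misses w, so c ≠ x; separating c from x gives d ∈ N_S[x] missing c, so d ≠ c.
module Submission where

open import Defs
open import Data.Nat using (ℕ; _≤_; _<_; z≤n; s≤s)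
open import Data.Nat.Properties using (≤-trans; +-mono-≤)
open import Data.Bool using (Bool; true; _∨_)
open import Data.Bool.Properties using (∨-zeroʳ)
open import Data.Fin using (Fin; _≟_)
import Data.Fin as Fin
open import Data.Fin.Properties using (any?)
open import Data.Fin.Subset using (Subset; _∈_; _∉_; _─_; ∣_∣)
open import Data.Fin.Subset.Properties
  using (_∈?_; ∣⁅x⁆∣≡1; x∈⁅y⁆⇒x≡y; p⊆q⇒∣p∣≤∣q∣; x∈p∧x≢y⇒x∈p-y; x∈p⇒∣p-x∣<∣p∣;
         x∈p∩q⁻; x∈p∧x∉q⇒x∈p─q)
open import Data.Vec using (tabulate)
open import Data.Vec.Properties using (lookup∘tabulate; []=⇒lookup; lookup⇒[]=)
open import Data.Product using (_×_; _,_; proj₁; proj₂; ∃)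
open import Data.Sum using (_⊎_; inj₁; inj₂)
open import Data.Empty using (⊥-elim)
open import Relation.Nullary using (yes; no)
open import Relation.Nullary.Decidable using (⌊_⌋; _×-dec_; ¬?; decidable-stable)
open import Relation.Binary.PropositionalEquality using (_≡_; _≢_; refl; sym; trans; cong; subst; ≢-sym)

private
  variable
    n : ℕ

x∈p⇒0<∣p∣ : {x : Fin n} {p : Subset n} → x ∈ p → 0 < ∣ p ∣
x∈p⇒0<∣p∣ {x = x} {p} x∈p = subst (_≤ ∣ p ∣) (∣⁅x⁆∣≡1 x)
  (p⊆q⇒∣p∣≤∣q∣ λ y∈⁅x⁆ → subst (_∈ p) (sym (x∈⁅y⁆⇒x≡y x y∈⁅x⁆)) x∈p)

x∈p∧y∈p∧x≢y⇒1<∣p∣ : {x y : Fin n} {p : Subset n} → x ∈ p → y ∈ p → x ≢ y → 1 < ∣ p ∣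
x∈p∧y∈p∧x≢y⇒1<∣p∣ x∈p y∈p x≢y =
  ≤-trans (s≤s (x∈p⇒0<∣p∣ (x∈p∧x≢y⇒x∈p-y y∈p (≢-sym x≢y)))) (x∈p⇒∣p-x∣<∣p∣ x∈p)

x∈tabulate⁺ : (f : Fin n → Bool) {x : Fin n} → f x ≡ true → x ∈ tabulate f
x∈tabulate⁺ f {x} fx = lookup⇒[]= x _ (trans (lookup∘tabulate f x) fx)

x∈tabulate⁻ : (f : Fin n → Bool) {x : Fin n} → x ∈ tabulate f → f x ≡ true
x∈tabulate⁻ f {x} x∈ = trans (sym (lookup∘tabulate f x)) ([]=⇒lookup x∈)

module _ (G : Graph n) where

  v∈N[v] : ∀ v → v ∈ N[ G ] v
  v∈N[v] v = x∈tabulate⁺ (λ u → ⌊ u ≟ v ⌋ ∨ adj G v u) {v} v≟v∨vv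
    where
    v≟v∨vv : ⌊ v ≟ v ⌋ ∨ adj G v v ≡ true
    v≟v∨vv with v ≟ v
    ... | yes _   = refl
    ... | no  v≢v = ⊥-elim (v≢v refl)

  adj⇒∈N[] : ∀ {u v} → adj G v u ≡ true → u ∈ N[ G ] v
  adj⇒∈N[] {u} {v} vu =
    x∈tabulate⁺ (λ u → ⌊ u ≟ v ⌋ ∨ adj G v u) (trans (cong (⌊ u ≟ v ⌋ ∨_) vu) (∨-zeroʳ _))

  ∈N[]⇒≡⊎adj : ∀ {u v} → u ∈ N[ G ] v → u ≡ v ⊎ adj G v u ≡ true
  ∈N[]⇒≡⊎adj {u} {v} u∈ with u ≟ v | x∈tabulate⁻ (λ u → ⌊ u ≟ v ⌋ ∨ adj G v u) u∈
  ... | yes u≡v | _  = inj₁ u≡v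
  ... | no _    | vu = inj₂ vu

  ∈N[]-sym : ∀ {u v} → u ∈ N[ G ] v → v ∈ N[ G ] u
  ∈N[]-sym {u} {v} u∈ with ∈N[]⇒≡⊎adj u∈
  ... | inj₁ refl = v∈N[v] u
  ... | inj₂ vu   = adj⇒∈N[] (trans (symmetric G u v) vu)

  adj⇒≢ : ∀ {u v} → adj G u v ≡ true → v ≢ u
  adj⇒≢ {u} uv refl with trans (sym uv) (irreflex G u)
  ... | ()

  walk⇒∃-neighbour : ∀ {x y} → x ≢ y → Walk (adj G) x y → ∃ λ w → adj G x w ≡ true
  walk⇒∃-neighbour x≢x here                 = ⊥-elim (x≢x refl)
  walk⇒∃-neighbour _   (there {w = w} xw _) = w , xw

∃-neighbour : 2 ≤ n → (G : Graph n) (x : Fin n) → ∃ λ w → adj G x w ≡ true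
∃-neighbour (s≤s (s≤s z≤n)) G Fin.zero    =
  walk⇒∃-neighbour G (λ ()) (connected G Fin.zero (Fin.suc Fin.zero))
∃-neighbour (s≤s (s≤s z≤n)) G (Fin.suc x) =
  walk⇒∃-neighbour G (λ ()) (connected G (Fin.suc x) Fin.zero)

module _ (G : Graph n) (S : Subset n) (sic : IsSIC G S) where

  sic-separates : ∀ {x y} → y ≢ x → ∃ λ c → c ∈ N[ G ] x ∩S S × y ∉ N[ G ] c
  sic-separates {x} {y} y≢x with any? (λ c → (c ∈? N[ G ] x ∩S S) ×-dec ¬? (y ∈? N[ G ] c))
  ... | yes separator = separator
  ... | no  none      = ⊥-elim (y≢x (proj₁ (proj₂ (sic x) y) y∈⋂))
    where
    y∈⋂ : InBigCap G S x y
    y∈⋂ c c∈ = decidable-stable (y ∈? N[ G ] c) (λ y∉ → none (c , c∈ , y∉))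

  sic⇒1<∣N[]∩S∣ : 2 ≤ n → ∀ x → 1 < ∣ N[ G ] x ∩S S ∣
  sic⇒1<∣N[]∩S∣ 2≤n x with ∃-neighbour 2≤n G x
  ... | w , xw with sic-separates (adj⇒≢ G xw)
  ... | c , c∈ , w∉ with sic-separates {y = c} (λ { refl → w∉ (adj⇒∈N[] G xw) })
  ... | d , d∈ , c∉ = x∈p∧y∈p∧x≢y⇒1<∣p∣ d∈ c∈ (λ { refl → c∉ (v∈N[v] G d) })

  sic⇒0<∣N[]∩S─N[]∩S∣ : ∀ {u v} → u ≢ v → 0 < ∣ (N[ G ] u ∩S S) ─ (N[ G ] v ∩S S) ∣
  sic⇒0<∣N[]∩S─N[]∩S∣ {u} {v} u≢v with sic-separates (≢-sym u≢v)
  ... | c , c∈ , v∉ =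
    x∈p⇒0<∣p∣ (x∈p∧x∉q⇒x∈p─q c∈ (λ c∈′ → v∉ (∈N[]-sym G (proj₁ (x∈p∩q⁻ _ _ c∈′)))))

mainTheorem4 : ∀ (n : ℕ) → 2 ≤ n → (G : Graph n) → (S : Subset n) →
                 IsSIC G S → IsREDIC G S
mainTheorem4 n 2≤n G S sic =
    sic⇒1<∣N[]∩S∣ G S sic 2≤n
  , λ u v u≢v → +-mono-≤ (sic⇒0<∣N[]∩S─N[]∩S∣ G S sic u≢v)
                          (sic⇒0<∣N[]∩S─N[]∩S∣ G S sic (≢-sym u≢v))
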